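{- Let $T$ be a finitely branching rooted tree in which, for each node $v$, the set of children of $v$ is equipped with a linear order $<_v$. Let $<$ be the lexicographic ordering on $T\cup[T]$ described in the context, and define \[ T'=\{v\in T \mid v<P \text{ for every } P\in[T]\}. \] Then the restriction of $<$ to $T'$ is order isomorphic to an initial segment of $\omega$. In addition, if $T$ is infinite, then $T'$ is infinite.
   Context: Write $v\sqsubseteq w$ if $v$ is an ancestor of $w$ in $T$, meaning $v$ lies on the path from the root to $w$. Let $[T]$ be the set of infinite paths through $T$ starting at the root. Each such path is identified with its set of nodes. The lexicographic order on nodes is defined as follows: - If $v\sqsubseteq w$ and $v\neq w$, then $v<w$. - If $v,w$ are $\sqsubseteq$-incomparable, let $u$ be their greatest common ancestor, and let $u',u''$ be the children of $u$ with $u'\sqsubseteq v$ and $u''\sqsubseteq w$. Then $v<w$ if and only if $u'<_u u''$. This is extended to $T\cup[T]$ by identifying a node $v$ with the set $\{v\}$. For $x,y\in T\cup[T]$, viewed as sets of nodes, set $x<y$ if and only if there exists $w\in y$ such that $v<w$ for all $v\in x$. -}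

module Defs where

open import Data.Nat using (ℕ; zero; suc; _<_; _≤_)
open import Data.List using (List; []; _∷_; _++_; [_]; applyUpTo)
open import Data.List.Membership.Propositional using (_∈_)
open import Data.Product using (Σ; ∃; ∃-syntax; _×_; _,_)
open import Relation.Nullary using (¬_)
open import Relation.Binary.PropositionalEquality using (_≡_)

-- Nodes of a tree are finite sequences of natural numbers (the path from
-- the root, [] being the root).  The child  v ++ [ i ]  of v is labelled
-- by i, and the linear order <_v on the children of v is the order of
-- their labels in ℕ.

record IsFinBranchingTree (T : List ℕ → Set) : Set where
  field
    root         : T []
    prefixClosed : ∀ v i → T (v ++ [ i ]) → T v
    finBranching : ∀ v → T v → ∃[ b ] (∀ i → T (v ++ [ i ]) → i < b)

data _<ₗ_ : List ℕ → List ℕ → Set where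
  anc   : ∀ {j w} → [] <ₗ (j ∷ w)
  here  : ∀ {i j v w} → i < j → (i ∷ v) <ₗ (j ∷ w)
  there : ∀ {i v w} → v <ₗ w → (i ∷ v) <ₗ (i ∷ w)

node : (ℕ → ℕ) → ℕ → List ℕ
node f n = applyUpTo f n

IsPath : (List ℕ → Set) → (ℕ → ℕ) → Set
IsPath T f = ∀ n → T (node f n)

-- v < P  for a node v and a path P (identified with its set of nodes):
-- there is a node w of P with v < w.
_<ₚ_ : List ℕ → (ℕ → ℕ) → Set
v <ₚ f = ∃[ n ] (v <ₗ node f n)

T′ : (List ℕ → Set) → List ℕ → Set
T′ T v = T v × (∀ f → IsPath T f → v <ₚ f)

Finite : (List ℕ → Set) → Set
Finite A = ∃[ xs ] (∀ v → A v → v ∈ xs)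

Infinite : (List ℕ → Set) → Set
Infinite A = ¬ Finite A

IsInitialSegmentω : (ℕ → Set) → Set
IsInitialSegmentω S = ∀ m n → m ≤ n → S n → S m

OrderIsoVia : (ℕ → Set) → (List ℕ → Set) → (ℕ → List ℕ) → Set
OrderIsoVia S A g =
    (∀ n → S n → A (g n))
  × (∀ v → A v → ∃[ n ] (S n × g n ≡ v))
  × (∀ m n → S m → S n → g m ≡ g n → m ≡ n)
  × (∀ m n → S m → S n → m < n → g m <ₗ g n)
  × (∀ m n → S m → S n → g m <ₗ g n → m < n)

IsoToInitialSegmentω : (List ℕ → Set) → Set₁
IsoToInitialSegmentω A =
  Σ (ℕ → Set) λ S → IsInitialSegmentω S × ∃[ g ] OrderIsoVia S A g

-- If v ∈ T′ had infinitely many predecessors in T, König's lemma applied to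
-- the finitely branching tree {u ∈ T | u < v} would give a path P lying
-- entirely below v, contradicting v < P.  So every element of T′ has finitely
-- many predecessors, and a linear order with that property is enumerated in
-- increasing order by repeatedly taking the least element above the previous
-- one.  If T is infinite, the nodes on the leftmost infinite branch all lie
-- in T′: a path that leaves this branch does so to the right of it, since
-- every node on a path has an infinite subtree.

module Submission where

open import Defs
open import Level using (0ℓ)
open import Axiom.ExcludedMiddle using (ExcludedMiddle)
open import Function using (_∘_)
open import Data.Nat using (ℕ; zero; suc; _+_; _<_; _≤_; _≤′_; ≤′-refl; ≤′-step)
open import Data.Nat.Properties
open import Data.Nat.Induction using (<-rec)
open import Data.Nat.ListAction using (sum)
open import Data.List using (List; []; _∷_; _++_; [_]; length; map; lookup)
open import Data.List.Properties using (++-assoc; ++-identityʳ; applyUpTo-∷ʳ; length-applyUpTo; length-++)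
open import Data.List.Membership.Propositional using (_∈_)
open import Data.List.Membership.Propositional.Properties using (∈-++⁺ˡ; ∈-++⁺ʳ)
open import Data.List.Relation.Unary.Any using (here; there; index)
open import Data.List.Relation.Unary.Any.Properties using (lookup-index)
open import Data.Fin using (Fin; toℕ)
import Data.Fin.Properties as Fin
open import Data.Maybe using (Maybe; just; nothing; fromMaybe; _>>=_)
open import Data.Product using (∃; ∃₂; ∃-syntax; _×_; _,_; proj₁; proj₂)
open import Data.Sum using (_⊎_; inj₁; inj₂)
open import Data.Unit using (⊤; tt)
open import Data.Empty using (⊥-elim)
open import Relation.Nullary using (¬_; yes; no)
open import Relation.Binary using (tri<; tri≈; tri>)
open import Relation.Binary.PropositionalEquality using (_≡_; refl; sym; trans; cong; subst; subst₂)

<ₗ-irrefl : ∀ {x} → ¬ x <ₗ x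
<ₗ-irrefl (here i<i) = <-irrefl refl i<i
<ₗ-irrefl (there x<x) = <ₗ-irrefl x<x

<ₗ-trans : ∀ {x y z} → x <ₗ y → y <ₗ z → x <ₗ z
<ₗ-trans anc       (here _)  = anc
<ₗ-trans anc       (there _) = anc
<ₗ-trans (here p)  (here q)  = here (<-trans p q)
<ₗ-trans (here p)  (there _) = here p
<ₗ-trans (there _) (here q)  = here q
<ₗ-trans (there p) (there q) = there (<ₗ-trans p q)

<ₗ-asym : ∀ {x y} → x <ₗ y → ¬ y <ₗ x
<ₗ-asym p q = <ₗ-irrefl (<ₗ-trans p q)

<ₗ-trichotomy : ∀ x y → x <ₗ y ⊎ x ≡ y ⊎ y <ₗ x
<ₗ-trichotomy []      []      = inj₂ (inj₁ refl)
<ₗ-trichotomy []      (j ∷ w) = inj₁ anc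
<ₗ-trichotomy (i ∷ v) []      = inj₂ (inj₂ anc)
<ₗ-trichotomy (i ∷ v) (j ∷ w) with <-cmp i j
... | tri< i<j _ _ = inj₁ (here i<j)
... | tri> _ _ j<i = inj₂ (inj₂ (here j<i))
... | tri≈ _ refl _ with <ₗ-trichotomy v w
...   | inj₁ v<w        = inj₁ (there v<w)
...   | inj₂ (inj₁ v≡w) = inj₂ (inj₁ (cong (i ∷_) v≡w))
...   | inj₂ (inj₂ w<v) = inj₂ (inj₂ (there w<v))

infix 4 _⊑_

_⊑_ : List ℕ → List ℕ → Set
u ⊑ w = ∃[ r ] w ≡ u ++ r

⊑-snoc : ∀ {u w} a → u ⊑ w → u ⊑ w ++ [ a ]
⊑-snoc {u} a (r , refl) = r ++ [ a ] , ++-assoc u r [ a ]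

<ₗ-extension : ∀ u a r → u <ₗ (u ++ a ∷ r)
<ₗ-extension []      a r = anc
<ₗ-extension (i ∷ u) a r = there (<ₗ-extension u a r)

<ₗ-branch : ∀ u {i j s r} → i < j → (u ++ i ∷ s) <ₗ (u ++ j ∷ r)
<ₗ-branch []      i<j = here i<j
<ₗ-branch (k ∷ u) i<j = there (<ₗ-branch u i<j)

⊑⇒<ₗ-snoc : ∀ {u w} a → u ⊑ w → u <ₗ (w ++ [ a ])
⊑⇒<ₗ-snoc {u} a (r , refl) = subst (u <ₗ_) (sym (++-assoc u r [ a ])) (extend r)
  where
  extend : ∀ r → u <ₗ (u ++ (r ++ [ a ]))
  extend []      = <ₗ-extension u a []
  extend (b ∷ r) = <ₗ-extension u b (r ++ [ a ])

<ₗ-cases : ∀ {u w} → u <ₗ w → (∃₂ λ j r → w ≡ u ++ j ∷ r) ⊎ (∀ s → (u ++ s) <ₗ w)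
<ₗ-cases (anc {j} {w}) = inj₁ (j , w , refl)
<ₗ-cases (here i<j)    = inj₂ λ _ → here i<j
<ₗ-cases (there {i} u<w) with <ₗ-cases u<w
... | inj₁ (j , r , w≡) = inj₁ (j , r , cong (i ∷_) w≡)
... | inj₂ right       = inj₂ λ s → there (right s)

node-suc : ∀ f n → node f (suc n) ≡ node f n ++ [ f n ]
node-suc f n = sym (applyUpTo-∷ʳ f n)

⊑-node-+ : ∀ f {u} m k → u ⊑ node f m → u ⊑ node f (k + m)
⊑-node-+ f {u} m zero    u⊑ = u⊑
⊑-node-+ f {u} m (suc k) u⊑ =
  subst (u ⊑_) (sym (node-suc f (k + m))) (⊑-snoc (f (k + m)) (⊑-node-+ f m k u⊑))

⊑-node⇒<ₗ-node-suc : ∀ f {u} n → u ⊑ node f n → u <ₗ node f (suc n)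
⊑-node⇒<ₗ-node-suc f {u} n u⊑ = subst (u <ₗ_) (sym (node-suc f n)) (⊑⇒<ₗ-snoc (f n) u⊑)

∈⇒length≤ : ∀ {x : List ℕ} {xs} → x ∈ xs → length x ≤ sum (map length xs)
∈⇒length≤ {xs = y ∷ ys} (here refl) = m≤m+n (length y) _
∈⇒length≤ {xs = y ∷ ys} (there x∈) = ≤-trans (∈⇒length≤ x∈) (m≤n+m _ (length y))

unbounded⇒Infinite : ∀ {A} → (∀ k → ∃[ v ] (A v × k ≤ length v)) → Infinite A
unbounded⇒Infinite unbounded (xs , cover) with unbounded (suc (sum (map length xs)))
... | v , av , long = <-irrefl refl (≤-trans long (∈⇒length≤ (cover v av)))

Finite-⋃< : (F : ℕ → List ℕ → Set) → ∀ b → (∀ i → i < b → Finite (F i)) →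
            Finite (λ w → ∃[ i ] (i < b × F i w))
Finite-⋃< F zero    _   = [] , λ { w (i , () , _) }
Finite-⋃< F (suc b) fin with fin b ≤-refl | Finite-⋃< F b (λ i i<b → fin i (m<n⇒m<1+n i<b))
... | xs , cover-b | ys , cover-<b = xs ++ ys , λ { w (i , i<1+b , Fiw) → cover w i (m<1+n⇒m<n∨m≡n i<1+b) Fiw }
  where
  cover : ∀ w i → i < b ⊎ i ≡ b → F i w → w ∈ xs ++ ys
  cover w i (inj₁ i<b)  Fiw = ∈-++⁺ʳ xs (cover-<b w (i , i<b , Fiw))
  cover w i (inj₂ refl) Fiw = ∈-++⁺ˡ (cover-b w Fiw)

pigeonhole-∈ : ∀ {X : Set} (xs : List X) (h : ℕ → X) → (∀ i → i ≤ length xs → h i ∈ xs) →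
               ∃₂ λ i j → i < j × j ≤ length xs × h i ≡ h j
pigeonhole-∈ xs h h∈ =
  let i , j , i<j , same-index = Fin.pigeonhole (n<1+n (length xs)) (index ∘ h∈′) in
  toℕ i , toℕ j , i<j , Fin.toℕ≤pred[n] j ,
  trans (lookup-index (h∈′ i)) (trans (cong (lookup xs) same-index) (sym (lookup-index (h∈′ j))))
  where
  h∈′ : (i : Fin (suc (length xs))) → h (toℕ i) ∈ xs
  h∈′ i = h∈ (toℕ i) (Fin.toℕ≤pred[n] i)

least-witness : ExcludedMiddle 0ℓ → {P : ℕ → Set} → ∃ P → ∃[ m ] (P m × ∀ k → k < m → ¬ P k)
least-witness em {P} (n , pn) = <-rec (λ n → P n → ∃[ m ] (P m × ∀ k → k < m → ¬ P k)) descend n pn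
  where
  descend : ∀ n → (∀ {k} → k < n → P k → ∃[ m ] (P m × ∀ k → k < m → ¬ P k)) →
            P n → ∃[ m ] (P m × ∀ k → k < m → ¬ P k)
  descend n smaller pn with em {∃[ k ] (k < n × P k)}
  ... | yes (k , k<n , pk) = smaller k<n pk
  ... | no none            = n , pn , λ k k<n pk → none (k , k<n , pk)

record IsFinBranching (B : List ℕ → Set) : Set where
  field
    prefixClosed : ∀ v i → B (v ++ [ i ]) → B v
    finBranching : ∀ v → B v → ∃[ b ] (∀ i → B (v ++ [ i ]) → i < b)

  prefixClosed⁺ : ∀ u r → B (u ++ r) → B u
  prefixClosed⁺ u []      b = subst B (++-identityʳ u) b
  prefixClosed⁺ u (a ∷ r) b =
    prefixClosed u a (prefixClosed⁺ (u ++ [ a ]) r (subst B (sym (++-assoc u [ a ] r)) b))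

tree⇒IsFinBranching : ∀ {T} → IsFinBranchingTree T → IsFinBranching T
tree⇒IsFinBranching t = record
  { prefixClosed = IsFinBranchingTree.prefixClosed t
  ; finBranching = IsFinBranchingTree.finBranching t
  }

Subtree : (List ℕ → Set) → List ℕ → List ℕ → Set
Subtree B u w = B w × u ⊑ w

Infinite⇒Infinite-Subtree-[] : ∀ {B} → Infinite B → Infinite (Subtree B [])
Infinite⇒Infinite-Subtree-[] inf (xs , cover) = inf (xs , λ w bw → cover w (bw , w , refl))

path⇒Infinite-Subtree : ∀ {B} f → IsPath B f → ∀ {u} n → u ⊑ node f n → Infinite (Subtree B u)
path⇒Infinite-Subtree f path n u⊑ = unbounded⇒Infinite λ k →
  node f (k + n) , (path (k + n) , ⊑-node-+ f n k u⊑) ,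
  subst (k ≤_) (sym (length-applyUpTo f (k + n))) (m≤m+n k n)

module König (em : ExcludedMiddle 0ℓ) {B : List ℕ → Set} (fb : IsFinBranching B) where
  open IsFinBranching fb

  Infinite-Subtree⇒node : ∀ {u} → Infinite (Subtree B u) → B u
  Infinite-Subtree⇒node {u} inf with em {B u}
  ... | yes bu = bu
  ... | no ¬bu = ⊥-elim (inf ([] , λ { w (bw , r , refl) → ⊥-elim (¬bu (prefixClosed⁺ u r bw)) }))

  -- The subtree of u is u together with the finitely many subtrees of its
  -- children, so one of those must be infinite.
  Infinite-Subtree⇒child : ∀ {u} → Infinite (Subtree B u) → ∃[ i ] Infinite (Subtree B (u ++ [ i ]))
  Infinite-Subtree⇒child {u} inf with em {∃[ i ] Infinite (Subtree B (u ++ [ i ]))}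
  ... | yes child = child
  ... | no ¬child = ⊥-elim (inf (u ∷ proj₁ children , cover))
    where
    bound : ∃[ b ] (∀ i → B (u ++ [ i ]) → i < b)
    bound = finBranching u (Infinite-Subtree⇒node inf)

    finite-child : ∀ i → i < proj₁ bound → Finite (Subtree B (u ++ [ i ]))
    finite-child i _ with em {Finite (Subtree B (u ++ [ i ]))}
    ... | yes fin = fin
    ... | no ¬fin = ⊥-elim (¬child (i , ¬fin))

    children : Finite (λ w → ∃[ i ] (i < proj₁ bound × Subtree B (u ++ [ i ]) w))
    children = Finite-⋃< (λ i → Subtree B (u ++ [ i ])) (proj₁ bound) finite-child

    cover : ∀ w → Subtree B u w → w ∈ u ∷ proj₁ children
    cover w (bw , []    , refl) = here (++-identityʳ u)
    cover w (bw , a ∷ r , refl) =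
      there (proj₂ children w (a , proj₂ bound a (prefixClosed⁺ (u ++ [ a ]) r bw′) , bw , r , w≡))
      where
      w≡ : u ++ a ∷ r ≡ (u ++ [ a ]) ++ r
      w≡ = sym (++-assoc u [ a ] r)
      bw′ : B ((u ++ [ a ]) ++ r)
      bw′ = subst B w≡ bw

  könig : Infinite B → ∃[ f ] IsPath B f
  könig inf = f , λ n → subst B (sym (node-branch n)) (Infinite-Subtree⇒node (proj₂ (branch n)))
    where
    extend : ∃ (Infinite ∘ Subtree B) → ∃ (Infinite ∘ Subtree B)
    extend (u , iu) = u ++ [ proj₁ (Infinite-Subtree⇒child iu) ] , proj₂ (Infinite-Subtree⇒child iu)

    branch : ℕ → ∃ (Infinite ∘ Subtree B)
    branch zero    = [] , Infinite⇒Infinite-Subtree-[] inf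
    branch (suc n) = extend (branch n)

    f : ℕ → ℕ
    f n = proj₁ (Infinite-Subtree⇒child (proj₂ (branch n)))

    node-branch : ∀ n → node f n ≡ proj₁ (branch n)
    node-branch zero    = refl
    node-branch (suc n) = trans (node-suc f n) (cong (_++ [ f n ]) (node-branch n))

IsFinBranching-below : ∀ {B} → IsFinBranching B → ∀ v → IsFinBranching (λ u → B u × u <ₗ v)
IsFinBranching-below fb v = record
  { prefixClosed = λ u i (bui , ui<v) → prefixClosed u i bui , <ₗ-trans (<ₗ-extension u i []) ui<v
  ; finBranching = λ u (bu , _) → proj₁ (finBranching u bu) , λ i (bui , _) → proj₂ (finBranching u bu) i bui
  }
  where open IsFinBranching fb

T′-predecessors-finite : ExcludedMiddle 0ℓ → ∀ {T} → IsFinBranchingTree T →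
                         ∀ {v} → T′ T v → Finite (λ u → T u × u <ₗ v)
T′-predecessors-finite em {T} t {v} (_ , v<paths) with em {Finite (λ u → T u × u <ₗ v)}
... | yes fin = fin
... | no inf with König.könig em (IsFinBranching-below (tree⇒IsFinBranching t) v) inf
...   | f , path-below-v with v<paths f (proj₁ ∘ path-below-v)
...     | n , v<node = ⊥-elim (<ₗ-asym v<node (proj₂ (path-below-v n)))

module Enumeration (em : ExcludedMiddle 0ℓ) (A : List ℕ → Set)
                   (predecessors-finite : ∀ {v} → A v → Finite (λ u → A u × u <ₗ v)) where

  _<ᵐ_ : Maybe (List ℕ) → List ℕ → Set
  nothing <ᵐ u = ⊤
  just x  <ᵐ u = x <ₗ u

  Candidate : Maybe (List ℕ) → List ℕ → Set
  Candidate b u = A u × b <ᵐ u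

  IsLeast : Maybe (List ℕ) → List ℕ → Set
  IsLeast b m = Candidate b m × (∀ u → Candidate b u → m ≡ u ⊎ m <ₗ u)

  least-among : ∀ b xs {y} → Candidate b y → (∀ u → Candidate b u → u <ₗ y → u ∈ xs) →
                ∃ (IsLeast b)
  least-among b [] {y} cy cover = y , cy , λ u cu → lower u cu (<ₗ-trichotomy u y)
    where
    lower : ∀ u → Candidate b u → u <ₗ y ⊎ u ≡ y ⊎ y <ₗ u → y ≡ u ⊎ y <ₗ u
    lower u cu (inj₁ u<y) with () ← cover u cu u<y
    lower u cu (inj₂ (inj₁ u≡y)) = inj₁ (sym u≡y)
    lower u cu (inj₂ (inj₂ y<u)) = inj₂ y<u
  least-among b (x ∷ xs) {y} cy cover with em {Candidate b x × x <ₗ y}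
  ... | yes (cx , x<y) = least-among b xs cx cover′
    where
    cover′ : ∀ u → Candidate b u → u <ₗ x → u ∈ xs
    cover′ u cu u<x with cover u cu (<ₗ-trans u<x x<y)
    ... | here refl = ⊥-elim (<ₗ-irrefl u<x)
    ... | there u∈  = u∈
  ... | no ¬x<y = least-among b xs cy cover′
    where
    cover′ : ∀ u → Candidate b u → u <ₗ y → u ∈ xs
    cover′ u cu u<y with cover u cu u<y
    ... | here refl = ⊥-elim (¬x<y (cu , u<y))
    ... | there u∈  = u∈

  least-candidate : ∀ {b y} → Candidate b y → ∃ (IsLeast b)
  least-candidate {b} cy@(ay , _) = least-among b (proj₁ fin) cy λ u (au , _) u<y → proj₂ fin u (au , u<y)
    where
    fin : Finite (λ u → A u × u <ₗ _)
    fin = predecessors-finite ay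

  next : Maybe (List ℕ) → Maybe (List ℕ)
  next b with em {∃ (IsLeast b)}
  ... | yes (m , _) = just m
  ... | no _        = nothing

  next-least : ∀ {b m} → next b ≡ just m → IsLeast b m
  next-least {b} with em {∃ (IsLeast b)}
  ... | yes (m , least) = λ { refl → least }
  ... | no _            = λ ()

  next-≤ : ∀ {b v} → Candidate b v → next b ≡ just v ⊎ ∃[ m ] (next b ≡ just m × m <ₗ v)
  next-≤ {b} {v} cv with em {∃ (IsLeast b)}
  ... | no none = ⊥-elim (none (least-candidate cv))
  ... | yes (m , _ , least) with least v cv
  ...   | inj₁ refl = inj₁ refl
  ...   | inj₂ m<v  = inj₂ (m , refl , m<v)

  -- The n-th element of A in increasing order, or nothing if A has at most n elements.
  enum : ℕ → Maybe (List ℕ)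
  enum zero    = next nothing
  enum (suc n) = enum n >>= next ∘ just

  S : ℕ → Set
  S n = ∃[ x ] enum n ≡ just x

  g : ℕ → List ℕ
  g n = fromMaybe [] (enum n)

  enum-suc : ∀ n {x} → enum n ≡ just x → enum (suc n) ≡ next (just x)
  enum-suc n e rewrite e = refl

  g-enum : ∀ n {x} → enum n ≡ just x → g n ≡ x
  g-enum n e rewrite e = refl

  S-pred : ∀ {n} → S (suc n) → S n
  S-pred {n} (y , e) with enum n
  ... | just x = x , refl

  enum-A : ∀ n {x} → enum n ≡ just x → A x
  enum-A zero    e = proj₁ (proj₁ (next-least e))
  enum-A (suc n) e with enum n
  ... | just _ = proj₁ (proj₁ (next-least e))

  enum-suc-> : ∀ n {x y} → enum n ≡ just x → enum (suc n) ≡ just y → x <ₗ y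
  enum-suc-> n ex ey = proj₂ (proj₁ (next-least (trans (sym (enum-suc n ex)) ey)))

  enum-increasing : ∀ {m n x y} → suc m ≤′ n → enum m ≡ just x → enum n ≡ just y → x <ₗ y
  enum-increasing {m}     ≤′-refl           ex ey = enum-suc-> m ex ey
  enum-increasing {n = suc n} (≤′-step m<n) ex ey with S-pred {n} (_ , ey)
  ... | z , ez = <ₗ-trans (enum-increasing m<n ex ez) (enum-suc-> n ez ey)

  initialSegment : IsInitialSegmentω S
  initialSegment m n m≤n = down (≤⇒≤′ m≤n)
    where
    down : ∀ {n} → m ≤′ n → S n → S m
    down ≤′-refl                 s = s
    down {suc n} (≤′-step m≤n) s = down m≤n (S-pred {n} s)

  g-increasing : ∀ m n → S m → S n → m < n → g m <ₗ g n
  g-increasing m n (x , ex) (y , ey) m<n =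
    subst₂ _<ₗ_ (sym (g-enum m ex)) (sym (g-enum n ey)) (enum-increasing (≤⇒≤′ m<n) ex ey)

  g-injective : ∀ m n → S m → S n → g m ≡ g n → m ≡ n
  g-injective m n sm sn gm≡gn with <-cmp m n
  ... | tri< m<n _ _ = ⊥-elim (<ₗ-irrefl (subst (_<ₗ g n) gm≡gn (g-increasing m n sm sn m<n)))
  ... | tri≈ _ m≡n _ = m≡n
  ... | tri> _ _ n<m = ⊥-elim (<ₗ-irrefl (subst (g n <ₗ_) gm≡gn (g-increasing n m sn sm n<m)))

  g-reflects : ∀ m n → S m → S n → g m <ₗ g n → m < n
  g-reflects m n sm sn gm<gn with <-cmp m n
  ... | tri< m<n _ _  = m<n
  ... | tri≈ _ refl _ = ⊥-elim (<ₗ-irrefl gm<gn)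
  ... | tri> _ _ n<m  = ⊥-elim (<ₗ-asym gm<gn (g-increasing n m sn sm n<m))

  g-A : ∀ n → S n → A (g n)
  g-A n (x , ex) = subst A (sym (g-enum n ex)) (enum-A n ex)

  approach : ∀ {v} → A v → ∀ n → (∃[ m ] enum m ≡ just v) ⊎ (∃[ x ] (enum n ≡ just x × x <ₗ v))
  approach av zero with next-≤ (av , tt)
  ... | inj₁ found = inj₁ (0 , found)
  ... | inj₂ below = inj₂ below
  approach av (suc n) with approach av n
  ... | inj₁ found = inj₁ found
  ... | inj₂ (x , ex , x<v) with next-≤ (av , x<v)
  ...   | inj₁ found          = inj₁ (suc n , trans (enum-suc n ex) found)
  ...   | inj₂ (y , ey , y<v) = inj₂ (y , trans (enum-suc n ex) ey , y<v)

  -- Otherwise g 0, …, g L would be L + 1 distinct predecessors of v.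
  enum-predecessors-exhausted : ∀ {v} (av : A v) {x} →
    enum (length (proj₁ (predecessors-finite av))) ≡ just x → ¬ x <ₗ v
  enum-predecessors-exhausted {v} av {x} ex x<v =
    let i , j , i<j , j≤L , gi≡gj = pigeonhole-∈ pre g g∈pre
    in <-irrefl (g-injective i j (S≤L i (<⇒≤ (<-≤-trans i<j j≤L))) (S≤L j j≤L) gi≡gj) i<j
    where
    pre : List (List ℕ)
    pre = proj₁ (predecessors-finite av)

    L : ℕ
    L = length pre

    S≤L : ∀ i → i ≤ L → S i
    S≤L i i≤L = initialSegment i L i≤L (x , ex)

    g<v : ∀ i → i ≤ L → g i <ₗ v
    g<v i i≤L with m≤n⇒m<n∨m≡n i≤L
    ... | inj₁ i<L  =
      <ₗ-trans (subst (g i <ₗ_) (g-enum L ex) (g-increasing i L (S≤L i i≤L) (x , ex) i<L)) x<v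
    ... | inj₂ refl = subst (_<ₗ v) (sym (g-enum L ex)) x<v

    g∈pre : ∀ i → i ≤ L → g i ∈ pre
    g∈pre i i≤L = proj₂ (predecessors-finite av) (g i) (g-A i (S≤L i i≤L) , g<v i i≤L)

  g-surjective : ∀ v → A v → ∃[ n ] (S n × g n ≡ v)
  g-surjective v av with approach av (length (proj₁ (predecessors-finite av)))
  ... | inj₁ (m , em≡v)     = m , (v , em≡v) , g-enum m em≡v
  ... | inj₂ (x , ex , x<v) = ⊥-elim (enum-predecessors-exhausted av ex x<v)

  isoToInitialSegmentω : IsoToInitialSegmentω A
  isoToInitialSegmentω =
    S , initialSegment , g , g-A , g-surjective , g-injective , g-increasing , g-reflects

T′-isoToInitialSegmentω : ExcludedMiddle 0ℓ → ∀ {T} → IsFinBranchingTree T → IsoToInitialSegmentω (T′ T)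
T′-isoToInitialSegmentω em {T} t = Enumeration.isoToInitialSegmentω em (T′ T) predecessors-finite
  where
  predecessors-finite : ∀ {v} → T′ T v → Finite (λ u → T′ T u × u <ₗ v)
  predecessors-finite t′v with T′-predecessors-finite em t t′v
  ... | xs , cover = xs , λ u (t′u , u<v) → cover u (proj₁ t′u , u<v)

-- A path leaving u through a child j < m would make the subtree of u ++ [ j ]
-- infinite.
leftmost-child-<ₚ : ∀ {T : List ℕ → Set} {u m} → (∀ f → IsPath T f → u <ₚ f) →
                    (∀ j → j < m → ¬ Infinite (Subtree T (u ++ [ j ]))) →
                    ∀ f → IsPath T f → (u ++ [ m ]) <ₚ f
leftmost-child-<ₚ {T} {u} {m} u<paths leftmost f path with u<paths f path
... | n , u<node with <ₗ-cases u<node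
...   | inj₂ right = n , right [ m ]
...   | inj₁ (j , r , node≡) with <-cmp m j
...     | tri< m<j _ _  = n , subst ((u ++ [ m ]) <ₗ_) (sym node≡) (<ₗ-branch u m<j)
...     | tri≈ _ refl _ = suc n , ⊑-node⇒<ₗ-node-suc f n (r , trans node≡ (sym (++-assoc u [ m ] r)))
...     | tri> _ _ j<m  =
          ⊥-elim (leftmost j j<m (path⇒Infinite-Subtree f path n (r , trans node≡ (sym (++-assoc u [ j ] r)))))

Infinite-T′ : ExcludedMiddle 0ℓ → ∀ {T} → IsFinBranchingTree T → Infinite T → Infinite (T′ T)
Infinite-T′ em {T} t inf = unbounded⇒Infinite λ k →
  let u , t′u , _ , len = leftmost-branch k in u , t′u , ≤-reflexive (sym len)
  where
  open König em (tree⇒IsFinBranching t)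

  leftmost-branch : ∀ k → ∃[ u ] (T′ T u × Infinite (Subtree T u) × length u ≡ k)
  leftmost-branch zero =
    [] , (IsFinBranchingTree.root t , λ f _ → 1 , anc) , Infinite⇒Infinite-Subtree-[] inf , refl
  leftmost-branch (suc k) with leftmost-branch k
  ... | u , (_ , u<paths) , iu , len
      with least-witness em (Infinite-Subtree⇒child iu)
  ...   | m , im , leftmost =
          u ++ [ m ] , (Infinite-Subtree⇒node im , leftmost-child-<ₚ u<paths leftmost) , im ,
          trans (length-++ u) (trans (+-comm (length u) 1) (cong suc len))

mainTheorem1 : ExcludedMiddle 0ℓ → (T : List ℕ → Set) → IsFinBranchingTree T →
    IsoToInitialSegmentω (T′ T) × (Infinite T → Infinite (T′ T))
mainTheorem1 em T t = T′-isoToInitialSegmentω em t , Infinite-T′ em t
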